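{- Let $q\in\mathrm{Dr}(n,2n)^{\mathrm{sd}}$ be a self-dual valuated matroid, and let $\mathcal{M}(q)$ be the set of rank $n$ matroids whose matroid polytopes are the cells of the matroid subdivision of the hypersimplex $\Delta(n,2n)$ induced by $q$. Then $\mathcal{M}(q)$ is closed under matroid duality: $\mathcal{M}(q)=\{M^*: M\in\mathcal{M}(q)\}$.
   Context: Vectors $q\in\mathbb{R}^{\binom{2n}{n}}$ are indexed by $n$-subsets $I$ of $[2n]$. The Dressian $\mathrm{Dr}(n,2n)$ is the set of valuated matroids: vectors $q$ satisfying the tropical quadratic Plücker relations (in each, the minimum is attained at least twice). Each such $q$ induces a regular subdivision of the hypersimplex $\Delta(n,2n)=\mathrm{conv}\{e_I\}$ (lifting vertex $e_I$ to height $q_I$, lower faces) all of whose cells are matroid polytopes $P_M=\mathrm{conv}\{e_I: I\text{ basis of }M\}$. Let $L=\{(\sum_{i\in I}\mu_i)_I:\mu\in\mathbb{R}^{2n}\}$ and $q^*_I=q_{[2n]\setminus I}$. The vector $q$ is self-dual if $q-q^*\in L$, and $\mathrm{Dr}(n,2n)^{\mathrm{sd}}$ is the set of self-dual elements of $\mathrm{Dr}(n,2n)$. The dual matroid $M^*$ has bases the complements of the bases of $M$. -}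

module Defs where

open import Level using (Level; _⊔_)
open import Data.Nat using (ℕ; zero; suc; _+_)
open import Data.Bool using (Bool; true; false; if_then_else_)
open import Data.Vec using (Vec; []; _∷_)
open import Data.Fin using (Fin; zero; suc)
open import Data.Fin.Subset using (Subset; _∈_; _∉_; ∁; _∪_; ⁅_⁆; ∣_∣) renaming (_-_ to _∖ₛ_)
open import Data.Product using (Σ; ∃; _×_; _,_)
open import Relation.Binary.PropositionalEquality using (_≡_; _≢_)
open import Relation.Binary.Structures using (IsTotalOrder)
open import Algebra.Bundles using (AbelianGroup)
open import Function.Bundles using (_⇔_)

-- A totally ordered abelian group (translation-invariant total order).
-- (ℝ, +, ≤) is an instance; the statement is made for all such groups.
record OrderedAbelianGroup (c ℓ₁ ℓ₂ : Level) : Set (Level.suc (c Level.⊔ ℓ₁ Level.⊔ ℓ₂)) where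
  field
    abelianGroup : AbelianGroup c ℓ₁
  open AbelianGroup abelianGroup public
  field
    _≤_          : Carrier → Carrier → Set ℓ₂
    isTotalOrder : IsTotalOrder _≈_ _≤_
    ∙-mono-≤     : ∀ {x y} z → x ≤ y → (x ∙ z) ≤ (y ∙ z)

module Over {c ℓ₁ ℓ₂ : Level} (G : OrderedAbelianGroup c ℓ₁ ℓ₂) where
  open OrderedAbelianGroup G

  _−_ : Carrier → Carrier → Carrier
  x − y = x ∙ (y ⁻¹)

  sumOver : ∀ {m} → (Fin m → Carrier) → Subset m → Carrier
  sumOver {zero}  c []      = ε
  sumOver {suc m} c (b ∷ p) = (if b then c zero else ε) ∙ sumOver (λ i → c (suc i)) p

  -- q is a vector indexed by n-subsets of [2n]; we model it as a function on all
  -- subsets of Fin (n + n), only its values on n-subsets are ever used.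
  Vector : ℕ → Set c
  Vector n = Subset (n + n) → Carrier

  -- Tropical quadratic Plücker relations: for S an (n-1)-subset and T an
  -- (n+1)-subset, the minimum over j ∈ T ∖ S of q(S ∪ j) + q(T ∖ j) is attained
  -- at least twice.
  term : ∀ {n} → Vector n → Subset (n + n) → Subset (n + n) → Fin (n + n) → Carrier
  term {n} q S T j = q (S ∪ ⁅ j ⁆) ∙ q (T ∖ₛ j)

  InDressian : (n : ℕ) → Vector n → Set (ℓ₁ ⊔ ℓ₂)
  InDressian n q =
    ∀ (S T : Subset (n + n)) → suc ∣ S ∣ ≡ n → ∣ T ∣ ≡ suc n →
    ∀ j → j ∈ T → j ∉ S →
    (∀ k → k ∈ T → k ∉ S → term {n} q S T j ≤ term {n} q S T k) →
    ∃ λ k → k ∈ T × k ∉ S × k ≢ j × (term {n} q S T k ≈ term {n} q S T j)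

  dualVec : ∀ {n} → Vector n → Vector n
  dualVec q I = q (∁ I)

  SelfDual : (n : ℕ) → Vector n → Set (c ⊔ ℓ₁)
  SelfDual n q = ∃ λ (μ : Fin (n + n) → Carrier) →
    ∀ (I : Subset (n + n)) → ∣ I ∣ ≡ n → (q I − dualVec {n} q I) ≈ sumOver μ I

  IsMatroidOfRank : (n : ℕ) → (Subset (n + n) → Set) → Set
  IsMatroidOfRank n B =
    (∃ λ I → B I) ×
    (∀ I → B I → ∣ I ∣ ≡ n) ×
    (∀ A A′ → B A → B A′ → ∀ a → a ∈ A → a ∉ A′ →
       ∃ λ b → b ∈ A′ × b ∉ A × B ((A ∖ₛ a) ∪ ⁅ b ⁆))

  dualBases : ∀ {m} → (Subset m → Set) → (Subset m → Set)
  dualBases B I = B (∁ I)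

  -- P_B is a cell (a face of the lower hull) of the regular subdivision induced
  -- by lifting e_I to height q_I: there is a linear functional c on ℝ^{2n} such
  -- that the vertices e_I of the face are exactly the minimisers of
  -- q_I + ⟨c, e_I⟩ over all n-subsets I.
  IsCell : (n : ℕ) → Vector n → (Subset (n + n) → Set) → Set (c ⊔ ℓ₂)
  IsCell n q B = ∃ λ (w : Fin (n + n) → Carrier) →
    ∀ (I : Subset (n + n)) → ∣ I ∣ ≡ n →
      B I ⇔ (∀ (J : Subset (n + n)) → ∣ J ∣ ≡ n →
               (q I ∙ sumOver w I) ≤ (q J ∙ sumOver w J))

  InMq : (n : ℕ) → Vector n → (Subset (n + n) → Set) → Set (c ⊔ ℓ₂)
  InMq n q B = IsMatroidOfRank n B × IsCell n q B

  InDualMq : (n : ℕ) → Vector n → (Subset (n + n) → Set) → Set (Level.suc Level.zero ⊔ c ⊔ ℓ₂)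
  InDualMq n q B = ∃ λ (B′ : Subset (n + n) → Set) →
    InMq n q B′ × (∀ I → B I ⇔ dualBases B′ I)

-- Complementation I ↦ [2n] ∖ I preserves n-subsets and turns the basis exchange axiom
-- into its dual form, which the bases of a matroid also satisfy, so M* is again a rank-n
-- matroid. On the polyhedral side, J ↦ q(∁ J) + ⟨w, e_{∁ J}⟩ and J ↦ q*_J − ⟨w, e_J⟩
-- differ by the constant ⟨w, 𝟙⟩, so they have the same minimisers: the cells of q* are
-- the duals of the cells of q. Since q − q* ∈ L, passing from q* to q only shifts the
-- linear functional w, so q and q* have the same cells.
module Submission where

open import Defs
open import Level using (Level)
open import Data.Nat as ℕ using (ℕ; suc; _+_; _∸_; s≤s)
open import Data.Nat.Properties
  using (≤-<-trans; ≤-reflexive; ≤⇒≯; n≤1+n; m+n∸n≡m; module ≤-Reasoning)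
open import Data.Nat.Induction using (<-wellFounded)
open import Induction.WellFounded using (Acc; acc)
open import Data.Bool using (Bool; true; false; not; if_then_else_)
open import Data.Vec using ([]; _∷_; here; there)
open import Data.Fin using (Fin; zero; suc; _≟_)
open import Data.Fin.Subset
open import Data.Fin.Subset.Properties
open import Data.Product using (∃; _×_; _,_)
open import Data.Sum using (_⊎_; inj₁; inj₂)
open import Function using (_∘_; case_of_)
open import Function.Bundles using (_⇔_; mk⇔; module Equivalence)
open import Function.Construct.Composition using (_⇔-∘_)
open import Function.Construct.Symmetry using (⇔-sym)
open import Function.Related.Propositional using (module EquationalReasoning)
open import Relation.Nullary using (¬_; yes; no; contradiction)
open import Relation.Binary.PropositionalEquality
  using (_≡_; _≢_; refl; sym; trans; cong; subst; module ≡-Reasoning)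
open import Relation.Binary.Structures using (IsTotalOrder)
import Relation.Binary.Reasoning.Setoid

private
  variable
    m : ℕ
    x : Fin m
    p q : Subset m

∁-involutive : (p : Subset m) → ∁ (∁ p) ≡ p
∁-involutive {m} = ¬-involutive
  where open import Algebra.Lattice.Properties.BooleanAlgebra (∪-∩-booleanAlgebra m)

∣p∣≡n⇒∣∁p∣≡n : ∀ {n} (p : Subset (n + n)) → ∣ p ∣ ≡ n → ∣ ∁ p ∣ ≡ n
∣p∣≡n⇒∣∁p∣≡n {n} p ∣p∣≡n = begin
  ∣ ∁ p ∣        ≡⟨ ∣∁p∣≡n∸∣p∣ p ⟩
  n + n ∸ ∣ p ∣  ≡⟨ cong (n + n ∸_) ∣p∣≡n ⟩
  n + n ∸ n      ≡⟨ m+n∸n≡m n n ⟩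
  n              ∎
  where open ≡-Reasoning

∣∁p∣≡n⇒∣p∣≡n : ∀ {n} (p : Subset (n + n)) → ∣ ∁ p ∣ ≡ n → ∣ p ∣ ≡ n
∣∁p∣≡n⇒∣p∣≡n {n} p ∣∁p∣≡n =
  subst (λ r → ∣ r ∣ ≡ n) (∁-involutive p) (∣p∣≡n⇒∣∁p∣≡n (∁ p) ∣∁p∣≡n)

x∈p─q⇒x∉q : x ∈ p ─ q → x ∉ q
x∈p─q⇒x∉q {p = _ ∷ _} {q = true ∷ _} () here
x∈p─q⇒x∉q {p = _ ∷ _} {q = _ ∷ _} (there x∈p─q) (there x∈q) = x∈p─q⇒x∉q x∈p─q x∈q

x∈p-y⇒x≢y : ∀ {y} → x ∈ p - y → x ≢ y
x∈p-y⇒x≢y x∈p-y = x∉⁅y⁆⇒x≢y (x∈p─q⇒x∉q x∈p-y)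

x∈p─q-y⇒x∈p∧x∉q∧x≢y : ∀ {y} → x ∈ (p ─ q) - y → x ∈ p × x ∉ q × x ≢ y
x∈p─q-y⇒x∈p∧x∉q∧x≢y x∈ = p─q⊆p _ _ (p─q⊆p _ _ x∈) , x∈p─q⇒x∉q (p─q⊆p _ _ x∈) , x∈p-y⇒x≢y x∈

x∈p∧x≢y⇒x∈p-y∪⁅z⁆ : ∀ {y z} → x ∈ p → x ≢ y → x ∈ (p - y) ∪ ⁅ z ⁆
x∈p∧x≢y⇒x∈p-y∪⁅z⁆ x∈p x≢y = x∈p∪q⁺ (inj₁ (x∈p∧x≢y⇒x∈p-y x∈p x≢y))

∣p∪⁅x⁆∣≤1+∣p∣ : (p : Subset m) (x : Fin m) → ∣ p ∪ ⁅ x ⁆ ∣ ℕ.≤ suc ∣ p ∣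
∣p∪⁅x⁆∣≤1+∣p∣ (true  ∷ p) zero    rewrite ∪-identityʳ p = n≤1+n _
∣p∪⁅x⁆∣≤1+∣p∣ (false ∷ p) zero    rewrite ∪-identityʳ p = ≤-reflexive refl
∣p∪⁅x⁆∣≤1+∣p∣ (true  ∷ p) (suc x) = s≤s (∣p∪⁅x⁆∣≤1+∣p∣ p x)
∣p∪⁅x⁆∣≤1+∣p∣ (false ∷ p) (suc x) = ∣p∪⁅x⁆∣≤1+∣p∣ p x

p⊆q∧∣q∣≤∣p∣⇒p≡q : p ⊆ q → ∣ q ∣ ℕ.≤ ∣ p ∣ → p ≡ q
p⊆q∧∣q∣≤∣p∣⇒p≡q {p = p} p⊆q ∣q∣≤∣p∣ = ⊆-antisym p⊆q q⊆p
  where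
  q⊆p : _ ⊆ p
  q⊆p {x} x∈q with x ∈? p
  ... | yes x∈p = x∈p
  ... | no  x∉p = contradiction (p⊂q⇒∣p∣<∣q∣ (p⊆q , x , x∈q , x∉p)) (≤⇒≯ ∣q∣≤∣p∣)

p⊆q-y∪⁅x⁆⇒p≡q-y∪⁅x⁆ : ∀ {y} → p ⊆ (q - y) ∪ ⁅ x ⁆ → y ∈ q → ∣ q ∣ ≡ ∣ p ∣ →
                       p ≡ (q - y) ∪ ⁅ x ⁆
p⊆q-y∪⁅x⁆⇒p≡q-y∪⁅x⁆ {q = q} {x = x} {y = y} p⊆ y∈q ∣q∣≡∣p∣ = p⊆q∧∣q∣≤∣p∣⇒p≡q p⊆ (begin
  ∣ (q - y) ∪ ⁅ x ⁆ ∣  ≤⟨ ∣p∪⁅x⁆∣≤1+∣p∣ (q - y) x ⟩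
  suc ∣ q - y ∣        ≤⟨ x∈p⇒∣p-x∣<∣p∣ y∈q ⟩
  ∣ q ∣                ≡⟨ ∣q∣≡∣p∣ ⟩
  _                    ∎)
  where open ≤-Reasoning

∣p-x∪⁅y⁆─q∣<∣p─q∣ : ∀ {y} → y ∈ q → x ∈ p → x ∉ q → ∣ (p - x) ∪ ⁅ y ⁆ ─ q ∣ ℕ.< ∣ p ─ q ∣
∣p-x∪⁅y⁆─q∣<∣p─q∣ {q = q} {x = x} {p = p} {y = y} y∈q x∈p x∉q =
  ≤-<-trans (p⊆q⇒∣p∣≤∣q∣ shrinks) (x∈p⇒∣p-x∣<∣p∣ (x∈p∧x∉q⇒x∈p─q x∈p x∉q))
  where
  shrinks : (p - x) ∪ ⁅ y ⁆ ─ q ⊆ (p ─ q) - x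
  shrinks {z} z∈ with x∈p∪q⁻ (p - x) ⁅ y ⁆ (p─q⊆p _ _ z∈)
  ... | inj₁ z∈p-x = x∈p∧x≢y⇒x∈p-y (x∈p∧x∉q⇒x∈p─q (p─q⊆p _ _ z∈p-x) (x∈p─q⇒x∉q z∈))
                                   (x∈p-y⇒x≢y z∈p-x)
  ... | inj₂ z∈⁅y⁆ = contradiction (subst (_∈ q) (sym (x∈⁅y⁆⇒x≡y y z∈⁅y⁆)) y∈q) (x∈p─q⇒x∉q z∈)

∁-exchange : ∀ {A : Subset m} {a b} → a ∈ A → b ∉ A → ∁ ((A - a) ∪ ⁅ b ⁆) ≡ (∁ A - b) ∪ ⁅ a ⁆
∁-exchange {A = A} {a} {b} a∈A b∉A = ⊆-antisym lhs⊆rhs rhs⊆lhs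
  where
  lhs⊆rhs : ∁ ((A - a) ∪ ⁅ b ⁆) ⊆ (∁ A - b) ∪ ⁅ a ⁆
  lhs⊆rhs {z} z∈∁ with z ≟ a
  ... | yes refl = x∈p∪q⁺ (inj₂ (x∈⁅x⁆ z))
  ... | no  z≢a  = x∈p∧x≢y⇒x∈p-y∪⁅z⁆ (x∉p⇒x∈∁p z∉A) z≢b
    where
    z∉A : z ∉ A
    z∉A z∈A = x∈∁p⇒x∉p z∈∁ (x∈p∧x≢y⇒x∈p-y∪⁅z⁆ z∈A z≢a)
    z≢b : z ≢ b
    z≢b refl = x∈∁p⇒x∉p z∈∁ (x∈p∪q⁺ (inj₂ (x∈⁅x⁆ z)))
  rhs⊆lhs : (∁ A - b) ∪ ⁅ a ⁆ ⊆ ∁ ((A - a) ∪ ⁅ b ⁆)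
  rhs⊆lhs {z} z∈ = x∉p⇒x∈∁p λ z∈′ → disjoint (x∈p∪q⁻ _ _ z∈) (x∈p∪q⁻ _ _ z∈′)
    where
    disjoint : z ∈ ∁ A - b ⊎ z ∈ ⁅ a ⁆ → ¬ (z ∈ A - a ⊎ z ∈ ⁅ b ⁆)
    disjoint (inj₁ h) (inj₁ k) = x∈∁p⇒x∉p (p─q⊆p _ _ h) (p─q⊆p _ _ k)
    disjoint (inj₁ h) (inj₂ k) = x∈p-y⇒x≢y h (x∈⁅y⁆⇒x≡y _ k)
    disjoint (inj₂ h) (inj₁ k) = x∈p-y⇒x≢y k (x∈⁅y⁆⇒x≡y _ h)
    disjoint (inj₂ h) (inj₂ k) =
      b∉A (subst (_∈ A) (trans (sym (x∈⁅y⁆⇒x≡y _ h)) (x∈⁅y⁆⇒x≡y _ k)) a∈A)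

BasisExchange : (Subset m → Set) → Set
BasisExchange B = ∀ A A′ → B A → B A′ → ∀ a → a ∈ A → a ∉ A′ →
  ∃ λ b → b ∈ A′ × b ∉ A × B ((A - a) ∪ ⁅ b ⁆)

DualBasisExchange : (Subset m → Set) → Set
DualBasisExchange B = ∀ A A′ → B A → B A′ → ∀ a → a ∈ A′ → a ∉ A →
  ∃ λ b → b ∈ A × b ∉ A′ × B ((A - b) ∪ ⁅ a ⁆)

-- Exchanging an element of C ∖ A other than a moves the basis C closer to A while
-- keeping a; once C ∖ A = {a}, any y ∈ A ∖ C gives C = A - y + a by counting.
basisExchange⇒dualBasisExchange : ∀ {k} {B : Subset m → Set} → BasisExchange B →
  (∀ I → B I → ∣ I ∣ ≡ k) → DualBasisExchange B
basisExchange⇒dualBasisExchange {B = B} exchange equicardinal A A′ bA bA′ =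
  go A′ (<-wellFounded _) bA′
  where
  go : ∀ C → Acc ℕ._<_ ∣ C ─ A ∣ → B C → ∀ a → a ∈ C → a ∉ A →
       ∃ λ b → b ∈ A × b ∉ C × B ((A - b) ∪ ⁅ a ⁆)
  go C (acc rec) bC a a∈C a∉A with nonempty? ((C ─ A) - a)
  ... | yes (x , x∈C─A-a) with x∈p─q-y⇒x∈p∧x∉q∧x≢y x∈C─A-a
  ...   | x∈C , x∉A , x≢a with exchange C A bC bA x x∈C x∉A
  ...     | y , y∈A , _ , bC′
          with go ((C - x) ∪ ⁅ y ⁆) (rec (∣p-x∪⁅y⁆─q∣<∣p─q∣ y∈A x∈C x∉A)) bC′
                  a (x∈p∧x≢y⇒x∈p-y∪⁅z⁆ a∈C (x≢a ∘ sym)) a∉A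
  ...       | b , b∈A , b∉C′ , bA-b+a = b , b∈A , b∉C , bA-b+a
    where
    b∉C : b ∉ C
    b∉C b∈C = b∉C′ (x∈p∧x≢y⇒x∈p-y∪⁅z⁆ b∈C λ { refl → x∉A b∈A })
  go C _ bC a a∈C a∉A | no C─A-a-empty with exchange C A bC bA a a∈C a∉A
  ... | y , y∈A , y∉C , _ = y , y∈A , y∉C , subst B C≡A-y+a bC
    where
    C⊆A-y+a : C ⊆ (A - y) ∪ ⁅ a ⁆
    C⊆A-y+a {z} z∈C with z ≟ a | z ∈? A
    ... | yes refl | _       = x∈p∪q⁺ (inj₂ (x∈⁅x⁆ z))
    ... | no  z≢a  | yes z∈A = x∈p∧x≢y⇒x∈p-y∪⁅z⁆ z∈A λ { refl → y∉C z∈C }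
    ... | no  z≢a  | no  z∉A =
      contradiction (z , x∈p∧x≢y⇒x∈p-y (x∈p∧x∉q⇒x∈p─q z∈C z∉A) z≢a) C─A-a-empty
    C≡A-y+a : C ≡ (A - y) ∪ ⁅ a ⁆
    C≡A-y+a = p⊆q-y∪⁅x⁆⇒p≡q-y∪⁅x⁆ C⊆A-y+a y∈A
                (trans (equicardinal A bA) (sym (equicardinal C bC)))

basisExchange-∁ : ∀ {k} {B : Subset m → Set} → BasisExchange B →
  (∀ I → B I → ∣ I ∣ ≡ k) → BasisExchange (B ∘ ∁)
basisExchange-∁ {B = B} exchange equicardinal A A′ b∁A b∁A′ a a∈A a∉A′
  with basisExchange⇒dualBasisExchange exchange equicardinal
         (∁ A) (∁ A′) b∁A b∁A′ a (x∉p⇒x∈∁p a∉A′) (x∈p⇒x∉∁p a∈A)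
... | b , b∈∁A , b∉∁A′ , bResult =
  b , x∉∁p⇒x∈p b∉∁A′ , x∈∁p⇒x∉p b∈∁A ,
  subst B (sym (∁-exchange a∈A (x∈∁p⇒x∉p b∈∁A))) bResult

module _ {c ℓ₁ ℓ₂ : Level} (G : OrderedAbelianGroup c ℓ₁ ℓ₂) where
  open OrderedAbelianGroup G renaming (refl to ≈-refl; sym to ≈-sym; trans to ≈-trans)
  open Over G
  open import Algebra.Properties.AbelianGroup abelianGroup
    using (⁻¹-∙-comm; ⁻¹-anti-homo‿-; xyx⁻¹≈y; //-rightDividesʳ)
  open import Algebra.Properties.CommutativeSemigroup commutativeSemigroup
    using (interchange; x∙yz≈xz∙y)
  open IsTotalOrder isTotalOrder using (≲-respˡ-≈; ≲-respʳ-≈)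
  module ≈-Reasoning = Relation.Binary.Reasoning.Setoid setoid

  isMatroidOfRank-dual : ∀ {n} {B : Subset (n + n) → Set} →
    IsMatroidOfRank n B → IsMatroidOfRank n (dualBases B)
  isMatroidOfRank-dual {B = B} ((I , bI) , equicardinal , exchange) =
    (∁ I , subst B (sym (∁-involutive I)) bI) ,
    (λ I b∁I → ∣∁p∣≡n⇒∣p∣≡n I (equicardinal (∁ I) b∁I)) ,
    basisExchange-∁ exchange equicardinal

  ≤-resp-≈ : ∀ {x x′ y y′} → x ≈ x′ → y ≈ y′ → x ≤ y → x′ ≤ y′
  ≤-resp-≈ x≈x′ y≈y′ x≤y = ≲-respʳ-≈ y≈y′ (≲-respˡ-≈ x≈x′ x≤y)

  ∙-shift : ∀ {x y m} s → x ∙ y ⁻¹ ≈ m → y ∙ s ≈ x ∙ (s ∙ m ⁻¹)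
  ∙-shift {x} {y} {m} s x∙y⁻¹≈m = begin
    y ∙ s                    ≈⟨ ∙-congʳ (xyx⁻¹≈y x y) ⟨
    (x ∙ y ∙ x ⁻¹) ∙ s       ≈⟨ ∙-congʳ (assoc x y (x ⁻¹)) ⟩
    (x ∙ (y ∙ x ⁻¹)) ∙ s     ≈⟨ ∙-congʳ (∙-congˡ (⁻¹-anti-homo‿- x y)) ⟨
    (x ∙ (x ∙ y ⁻¹) ⁻¹) ∙ s  ≈⟨ ∙-congʳ (∙-congˡ (⁻¹-cong x∙y⁻¹≈m)) ⟩
    (x ∙ m ⁻¹) ∙ s           ≈⟨ x∙yz≈xz∙y x s (m ⁻¹) ⟨
    x ∙ (s ∙ m ⁻¹)           ∎
    where open ≈-Reasoning

  ∙-cancelʳ-≤ : ∀ {x y} z → (x ∙ z) ≤ (y ∙ z) → x ≤ y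
  ∙-cancelʳ-≤ {x} {y} z xz≤yz =
    ≤-resp-≈ (//-rightDividesʳ z x) (//-rightDividesʳ z y) (∙-mono-≤ (z ⁻¹) xz≤yz)

  -- sumOver u (b ∷ p) unfolds to u zero when b ∙ sumOver (u ∘ suc) p.
  infix 8 _when_
  _when_ : Carrier → Bool → Carrier
  x when b = if b then x else ε

  when-∙⁻¹ : ∀ b x y → (x ∙ y ⁻¹) when b ≈ x when b ∙ (y when b) ⁻¹
  when-∙⁻¹ true  x y = ≈-refl
  when-∙⁻¹ false x y = ≈-sym (inverseʳ ε)

  when-not : ∀ b x → x when not b ≈ (x ⁻¹) when b ∙ x
  when-not true  x = ≈-sym (inverseˡ x)
  when-not false x = ≈-sym (identityˡ x)

  sumOver-∙⁻¹ : (u v : Fin m → Carrier) (p : Subset m) →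
                sumOver (λ i → u i ∙ v i ⁻¹) p ≈ sumOver u p ∙ sumOver v p ⁻¹
  sumOver-∙⁻¹ u v [] = ≈-sym (inverseʳ ε)
  sumOver-∙⁻¹ u v (b ∷ p) = begin
    (u zero ∙ v zero ⁻¹) when b ∙ sumOver (λ i → u (suc i) ∙ v (suc i) ⁻¹) p
      ≈⟨ ∙-cong (when-∙⁻¹ b _ _) (sumOver-∙⁻¹ (u ∘ suc) (v ∘ suc) p) ⟩
    (u zero when b ∙ (v zero when b) ⁻¹) ∙ (sumOver (u ∘ suc) p ∙ sumOver (v ∘ suc) p ⁻¹)
      ≈⟨ interchange _ _ _ _ ⟩
    (u zero when b ∙ sumOver (u ∘ suc) p) ∙ ((v zero when b) ⁻¹ ∙ sumOver (v ∘ suc) p ⁻¹)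
      ≈⟨ ∙-congˡ (⁻¹-∙-comm _ _) ⟩
    (u zero when b ∙ sumOver (u ∘ suc) p) ∙ (v zero when b ∙ sumOver (v ∘ suc) p) ⁻¹ ∎
    where open ≈-Reasoning

  sumOver-∁ : (u : Fin m → Carrier) (p : Subset m) →
              sumOver u (∁ p) ≈ sumOver (λ i → u i ⁻¹) p ∙ sumOver u ⊤
  sumOver-∁ u [] = ≈-sym (identityˡ ε)
  sumOver-∁ u (b ∷ p) = begin
    u zero when not b ∙ sumOver (u ∘ suc) (∁ p)
      ≈⟨ ∙-cong (when-not b _) (sumOver-∁ (u ∘ suc) p) ⟩
    ((u zero ⁻¹) when b ∙ u zero) ∙ (sumOver (λ i → u (suc i) ⁻¹) p ∙ sumOver (u ∘ suc) ⊤)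
      ≈⟨ interchange _ _ _ _ ⟩
    ((u zero ⁻¹) when b ∙ sumOver (λ i → u (suc i) ⁻¹) p) ∙ (u zero ∙ sumOver (u ∘ suc) ⊤) ∎
    where open ≈-Reasoning

  Minimises : (n : ℕ) → (Subset (n + n) → Carrier) → Subset (n + n) → Set ℓ₂
  Minimises n f I = ∀ J → ∣ J ∣ ≡ n → f I ≤ f J

  minimises-∙ʳ : ∀ n {f g : Subset (n + n) → Carrier} {I} T →
    (∀ J → ∣ J ∣ ≡ n → f J ≈ g J ∙ T) → ∣ I ∣ ≡ n → Minimises n f I ⇔ Minimises n g I
  minimises-∙ʳ n {f} {g} {I} T f≈g∙T ∣I∣≡n = mk⇔
    (λ f-min J ∣J∣≡n → ∙-cancelʳ-≤ T (≤-resp-≈ (f≈g∙T I ∣I∣≡n) (f≈g∙T J ∣J∣≡n)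
                                                  (f-min J ∣J∣≡n)))
    (λ g-min J ∣J∣≡n → ≤-resp-≈ (≈-sym (f≈g∙T I ∣I∣≡n)) (≈-sym (f≈g∙T J ∣J∣≡n))
                                (∙-mono-≤ T (g-min J ∣J∣≡n)))

  minimises-∁ : ∀ n {f : Subset (n + n) → Carrier} {I} → Minimises n f (∁ I) ⇔ Minimises n (f ∘ ∁) I
  minimises-∁ n {f} = mk⇔
    (λ min J ∣J∣≡n → min (∁ J) (∣p∣≡n⇒∣∁p∣≡n J ∣J∣≡n))
    (λ min K ∣K∣≡n → subst (λ K′ → f _ ≤ f K′) (∁-involutive K)
                           (min (∁ K) (∣p∣≡n⇒∣∁p∣≡n K ∣K∣≡n)))

  isCell-dual : ∀ {n} {q : Vector n} {B : Subset (n + n) → Set} →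
    IsCell n q B → IsCell n (dualVec {n} q) (dualBases B)
  isCell-dual {n} {q} {B} (w , cell) = w⁻¹ , λ I ∣I∣≡n → begin
    B (∁ I)                     ∼⟨ cell (∁ I) (∣p∣≡n⇒∣∁p∣≡n I ∣I∣≡n) ⟩
    Minimises n lift (∁ I)      ∼⟨ minimises-∁ n ⟩
    Minimises n (lift ∘ ∁) I    ∼⟨ minimises-∙ʳ n T lift∘∁≈dualLift∙T ∣I∣≡n ⟩
    Minimises n dualLift I      ∎
    where
    open EquationalReasoning
    w⁻¹ : Fin (n + n) → Carrier
    w⁻¹ i = w i ⁻¹
    T = sumOver w ⊤
    lift dualLift : Subset (n + n) → Carrier
    lift K = q K ∙ sumOver w K
    dualLift J = dualVec {n} q J ∙ sumOver w⁻¹ J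
    lift∘∁≈dualLift∙T : ∀ J → ∣ J ∣ ≡ n → lift (∁ J) ≈ dualLift J ∙ T
    lift∘∁≈dualLift∙T J _ = ≈-trans (∙-congˡ (sumOver-∁ w J)) (≈-sym (assoc _ _ _))

  isCell-shift : ∀ {n} {q q′ : Vector n} {B : Subset (n + n) → Set} (μ : Fin (n + n) → Carrier) →
    (∀ I → ∣ I ∣ ≡ n → (q I − q′ I) ≈ sumOver μ I) → IsCell n q′ B → IsCell n q B
  isCell-shift {n} {q} {q′} {B} μ q−q′≈μ (w , cell) = w−μ , λ I ∣I∣≡n → begin
    B I                     ∼⟨ cell I ∣I∣≡n ⟩
    Minimises n lift′ I     ∼⟨ minimises-∙ʳ n ε lift′≈lift∙ε ∣I∣≡n ⟩
    Minimises n lift I      ∎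
    where
    open EquationalReasoning
    w−μ : Fin (n + n) → Carrier
    w−μ i = w i ∙ μ i ⁻¹
    lift lift′ : Subset (n + n) → Carrier
    lift J = q J ∙ sumOver w−μ J
    lift′ J = q′ J ∙ sumOver w J
    lift′≈lift∙ε : ∀ J → ∣ J ∣ ≡ n → lift′ J ≈ lift J ∙ ε
    lift′≈lift∙ε J ∣J∣≡n =
      ≈-trans (∙-shift (sumOver w J) (q−q′≈μ J ∣J∣≡n))
              (≈-sym (≈-trans (identityʳ _) (∙-congˡ (sumOver-∙⁻¹ w μ J))))

  isCell-selfDual : ∀ {n} {q : Vector n} {B : Subset (n + n) → Set} →
    SelfDual n q → IsCell n q B → IsCell n q (dualBases B)
  isCell-selfDual (μ , q−q*≈μ) = isCell-shift μ q−q*≈μ ∘ isCell-dual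

  isMatroidOfRank-resp-⇔ : ∀ {n} {B B′ : Subset (n + n) → Set} → (∀ I → B I ⇔ B′ I) →
    IsMatroidOfRank n B → IsMatroidOfRank n B′
  isMatroidOfRank-resp-⇔ B⇔B′ ((I , bI) , equicardinal , exchange) =
    (I , to (B⇔B′ I) bI) ,
    (λ I b′I → equicardinal I (from (B⇔B′ I) b′I)) ,
    λ A A′ b′A b′A′ a a∈A a∉A′ →
      case exchange A A′ (from (B⇔B′ A) b′A) (from (B⇔B′ A′) b′A′) a a∈A a∉A′ of λ where
        (b , b∈A′ , b∉A , bResult) → b , b∈A′ , b∉A , to (B⇔B′ _) bResult
    where open Equivalence

  isCell-resp-⇔ : ∀ {n} {q : Vector n} {B B′ : Subset (n + n) → Set} → (∀ I → B I ⇔ B′ I) →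
    IsCell n q B → IsCell n q B′
  isCell-resp-⇔ B⇔B′ (w , cell) = w , λ I ∣I∣≡n → cell I ∣I∣≡n ⇔-∘ ⇔-sym (B⇔B′ I)

  inMq-dual : ∀ {n} {q : Vector n} {B : Subset (n + n) → Set} →
    SelfDual n q → InMq n q B → InMq n q (dualBases B)
  inMq-dual selfDual (matroid , cell) = isMatroidOfRank-dual matroid , isCell-selfDual selfDual cell

  inMq-resp-⇔ : ∀ {n} {q : Vector n} {B B′ : Subset (n + n) → Set} → (∀ I → B I ⇔ B′ I) →
    InMq n q B → InMq n q B′
  inMq-resp-⇔ B⇔B′ (matroid , cell) = isMatroidOfRank-resp-⇔ B⇔B′ matroid , isCell-resp-⇔ B⇔B′ cell

dualBases-involutive : ∀ {B : Subset m → Set} I → B I ⇔ B (∁ (∁ I))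
dualBases-involutive {B = B} I = mk⇔ (subst B (sym (∁-involutive I))) (subst B (∁-involutive I))

proposition6p2 : ∀ {c ℓ₁ ℓ₂ : Level} (G : OrderedAbelianGroup c ℓ₁ ℓ₂) (n : ℕ)
    (q : Over.Vector G n) → Over.InDressian G n q → Over.SelfDual G n q →
    ∀ (B : Subset (n + n) → Set) → Over.InMq G n q B ⇔ Over.InDualMq G n q B
proposition6p2 G n q _ selfDual B = mk⇔
  (λ B∈Mq → Over.dualBases G B , inMq-dual G selfDual B∈Mq , dualBases-involutive)
  (λ { (B′ , B′∈Mq , B⇔B′*) → inMq-resp-⇔ G (⇔-sym ∘ B⇔B′*) (inMq-dual G selfDual B′∈Mq) })
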